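{- Let $G=(V,E)$ be a temporal graph, $s\in V$, $t_s$ real. At any moment during the temporal BFS of $G$ from $s$ starting at $t_s$, the queue $Q$ contains at most two records involving the same vertex $v$, for every $v\in V$.
   Context: A temporal graph is $G=(V,E)$ with $V$ a finite vertex set and $E$ a finite set of temporal edges $(u,v,t)$, $u\neq v$, $t$ real; distinct temporal edges from $u$ to $v$ have distinct times. BFS from $s$ with starting time $t_s$: keep $\sigma(x)$ (time most recently assigned to $x$), initially $\infty$; FIFO queue $Q$ of records $(x,d,\tau,p)$ (vertex, hop count, time, predecessor). Set $\sigma(s)=t_s$, push $(s,0,t_s,\text{none})$. While $Q\neq\emptyset$: pop $(u,d_u,\tau_u,p_u)$; for each out-neighbor $v$ of $u$ with $E_{u,v}\neq\emptyset$, where $E_{u,v}$ is the set of not-yet-traversed edges $(u,v,t)\in E$ with $\tau_u\le t$, traverse the edge $(u,v,t)$ of $E_{u,v}$ of minimum time; then (i) if $Q$ has no record of $v$: if $\sigma(v)>t$, set $\sigma(v)=t$ and push $(v,d_u+1,t,\text{popped record})$; (ii) else if $Q$ has a record of $v$ with hop count $d_u+1$: if $\sigma(v)>t$, set $\sigma(v)=t$ and set that record's time to $t$ and predecessor to the popped record; (iii) else (the record of $v$ in $Q$ has hop count $d_u$): if $\sigma(v)>t$, set $\sigma(v)=t$ and push $(v,d_u+1,t,\text{popped record})$. -}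

module Defs where

open import Data.Nat using (ℕ; zero; suc; _≤_)
open import Data.Fin using (Fin; _≟_)
open import Data.Fin.Base using ()
open import Data.List using (List; []; _∷_; _++_; [_]; filter; length; allFin)
open import Data.List.Membership.Propositional using (_∈_; _∉_)
open import Data.List.Relation.Binary.Permutation.Propositional using (_↭_)
open import Data.Maybe using (Maybe; just; nothing)
open import Data.Product using (_×_; _,_)
open import Data.Sum using (_⊎_)
open import Data.Unit using (⊤)
open import Relation.Binary.PropositionalEquality using (_≡_; _≢_)
open import Relation.Binary.Construct.Closure.ReflexiveTransitive using (Star)
open import Relation.Nullary using (¬_; yes; no)

record Edge (T : Set) (n : ℕ) : Set where
  constructor edge
  field
    src  : Fin n
    dst  : Fin n
    time : T
open Edge public

-- A temporal graph: vertex set Fin n, finite edge set given by a list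
-- (read as a set; membership via _∈_).
-- Distinct edges from u to v automatically have distinct times, since an
-- edge is identified with its triple (u,v,t).
Loopless : {T : Set} {n : ℕ} → List (Edge T n) → Set
Loopless E = ∀ e → e ∈ E → src e ≢ dst e

module TBFS {T : Set} (_<_ : T → T → Set) {n : ℕ} (E : List (Edge T n)) where

  _≤ₜ_ : T → T → Set
  t ≤ₜ t' = (t < t') ⊎ (t ≡ t')

  -- σ(x) > t, where σ(x) = nothing represents ∞.
  _>σ_ : Maybe T → T → Set
  nothing >σ t = ⊤
  just s  >σ t = t < s

  -- Queue records (vertex, hop count, time, predecessor).
  data Rec : Set where
    rec : Fin n → ℕ → T → Maybe Rec → Rec

  vertex : Rec → Fin n
  vertex (rec x _ _ _) = x

  hop : Rec → ℕ
  hop (rec _ d _ _) = d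

  rtime : Rec → T
  rtime (rec _ _ τ _) = τ

  -- Algorithm state.  cur = just (r , vs) : record r has been popped and
  -- the out-neighbours in vs remain to be examined (in that order).
  record State : Set where
    constructor ⟨_,_,_,_⟩
    field
      σ     : Fin n → Maybe T
      Q     : List Rec
      trav  : List (Edge T n)
      cur   : Maybe (Rec × List (Fin n))
  open State public

  setσ : (Fin n → Maybe T) → Fin n → T → Fin n → Maybe T
  setσ σ v t x with x ≟ v
  ... | yes _ = just t
  ... | no  _ = σ x

  -- e ∈ E_{u,v} for the popped record r (u = vertex r, τ_u = rtime r),
  -- given the list tr of already traversed edges.
  Eligible : List (Edge T n) → Rec → Fin n → Edge T n → Set
  Eligible tr r v e =
    (e ∈ E) × (e ∉ tr) × (src e ≡ vertex r) × (dst e ≡ v) × (rtime r ≤ₜ time e)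

  MinEligible : List (Edge T n) → Rec → Fin n → Edge T n → Set
  MinEligible tr r v e =
    Eligible tr r v e × (∀ e' → Eligible tr r v e' → time e ≤ₜ time e')

  -- One elementary step of the BFS.  The order in which the out-neighbours
  -- of a popped vertex are examined is arbitrary (any permutation).
  data _⟶_ : State → State → Set where
    pop : ∀ {σ r Q tr vs} → vs ↭ allFin n →
          ⟨ σ , r ∷ Q , tr , nothing ⟩ ⟶ ⟨ σ , Q , tr , just (r , vs) ⟩
    finish : ∀ {σ r Q tr} →
          ⟨ σ , Q , tr , just (r , []) ⟩ ⟶ ⟨ σ , Q , tr , nothing ⟩
    skip : ∀ {σ r Q tr v vs} → (∀ e → ¬ Eligible tr r v e) →
          ⟨ σ , Q , tr , just (r , v ∷ vs) ⟩ ⟶ ⟨ σ , Q , tr , just (r , vs) ⟩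
    trav-none : ∀ {σ r Q tr v vs e} → MinEligible tr r v e →
          ¬ (σ v >σ time e) →
          ⟨ σ , Q , tr , just (r , v ∷ vs) ⟩ ⟶ ⟨ σ , Q , e ∷ tr , just (r , vs) ⟩
    -- case (ii): Q has a record of v with hop count d_u + 1.
    trav-update : ∀ {σ r Q₁ q Q₂ tr v vs e} → MinEligible tr r v e →
          σ v >σ time e → vertex q ≡ v → hop q ≡ suc (hop r) →
          ⟨ σ , Q₁ ++ q ∷ Q₂ , tr , just (r , v ∷ vs) ⟩ ⟶
          ⟨ setσ σ v (time e) , Q₁ ++ rec v (hop q) (time e) (just r) ∷ Q₂
          , e ∷ tr , just (r , vs) ⟩
    -- cases (i) and (iii): Q has no record of v with hop count d_u + 1.
    trav-push : ∀ {σ r Q tr v vs e} → MinEligible tr r v e →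
          σ v >σ time e →
          (∀ q → q ∈ Q → vertex q ≡ v → hop q ≢ suc (hop r)) →
          ⟨ σ , Q , tr , just (r , v ∷ vs) ⟩ ⟶
          ⟨ setσ σ v (time e) , Q ++ [ rec v (suc (hop r)) (time e) (just r) ]
          , e ∷ tr , just (r , vs) ⟩

  initial : Fin n → T → State
  initial s ts =
    ⟨ setσ (λ _ → nothing) s ts , [ rec s 0 ts nothing ] , [] , nothing ⟩

  Reachable : Fin n → T → State → Set
  Reachable s ts st = Star _⟶_ (initial s ts) st

  count : Fin n → List Rec → ℕ
  count v qs = length (filter (λ q → vertex q ≟ v) qs)

module Submission where

-- Identify a record by its key (vertex, hop count).  We show that in every
-- reachable state the queue Q has the following shape, for some b:
--   (1) the keys of the records in Q are pairwise distinct, and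
--   (2) the hop counts along Q form a sequence b … b (b+1) … (b+1),
-- where b is the hop count of the record currently being processed.
-- Case (ii) of the algorithm overwrites a record without changing its key,
-- a push appends a record with the fresh key (v , b+1), and a pop makes the
-- popped hop count the new base b.  Given the shape, the records of a fixed
-- vertex v have pairwise distinct keys among (v , b) and (v , b+1), hence
-- there are at most two of them.

open import Defs
open import Data.Nat using (ℕ; suc; _≤_; z≤n; s≤s)
open import Data.Fin using (Fin; _≟_)
open import Data.List using (List; []; _∷_; _++_; [_]; map; filter; length)
open import Data.List.Properties using (map-++; length-map)
open import Data.List.Membership.Propositional using (_∈_; _∉_)
open import Data.List.Membership.Propositional.Properties using (∈-map⁻)
open import Data.List.Relation.Unary.Any using (here)
open import Data.List.Relation.Unary.All using (All; []; _∷_)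
import Data.List.Relation.Unary.All as All
import Data.List.Relation.Unary.All.Properties as All
open import Data.List.Relation.Unary.AllPairs using ([]; _∷_)
import Data.List.Relation.Unary.AllPairs.Properties as AllPairs
open import Data.List.Relation.Unary.Unique.Propositional using (Unique)
import Data.List.Relation.Unary.Unique.Propositional.Properties as Unique
open import Data.Maybe using (just; nothing)
open import Data.Product using (∃; _×_; _,_; proj₁; proj₂)
open import Data.Sum using (_⊎_; inj₁; inj₂)
open import Data.Empty using (⊥-elim)
open import Function using (_∘_; id)
open import Relation.Binary.PropositionalEquality
  using (_≡_; _≢_; refl; sym; cong; cong₂; subst; module ≡-Reasoning)
open import Relation.Binary.Structures using (IsStrictTotalOrder)
open import Relation.Binary.Construct.Closure.ReflexiveTransitive using (fold)

OneOf : {A : Set} → A → A → A → Set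
OneOf x y z = z ≡ x ⊎ z ≡ y

two-agree : {A : Set} {x y a b c : A} →
            OneOf x y a → OneOf x y b → OneOf x y c →
            a ≡ b ⊎ a ≡ c ⊎ b ≡ c
two-agree (inj₁ refl) (inj₁ refl) _           = inj₁ refl
two-agree (inj₂ refl) (inj₂ refl) _           = inj₁ refl
two-agree (inj₁ refl) (inj₂ refl) (inj₁ refl) = inj₂ (inj₁ refl)
two-agree (inj₁ refl) (inj₂ refl) (inj₂ refl) = inj₂ (inj₂ refl)
two-agree (inj₂ refl) (inj₁ refl) (inj₁ refl) = inj₂ (inj₂ refl)
two-agree (inj₂ refl) (inj₁ refl) (inj₂ refl) = inj₂ (inj₁ refl)

unique-two-valued : {A : Set} {x y : A} (zs : List A) →
                    Unique zs → All (OneOf x y) zs → length zs ≤ 2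
unique-two-valued []               _ _ = z≤n
unique-two-valued (_ ∷ [])         _ _ = s≤s z≤n
unique-two-valued (_ ∷ _ ∷ [])     _ _ = s≤s (s≤s z≤n)
unique-two-valued (a ∷ b ∷ c ∷ _)
  ((a≢b ∷ a≢c ∷ _) ∷ (b≢c ∷ _) ∷ _) (pa ∷ pb ∷ pc ∷ _)
  with two-agree pa pb pc
... | inj₁ a≡b        = ⊥-elim (a≢b a≡b)
... | inj₂ (inj₁ a≡c) = ⊥-elim (a≢c a≡c)
... | inj₂ (inj₂ b≡c) = ⊥-elim (b≢c b≡c)

data Layered (b : ℕ) : List ℕ → Set where
  low  : ∀ {hs} → Layered b hs → Layered b (b ∷ hs)
  high : ∀ {hs} → All (_≡ suc b) hs → Layered b hs

constant-layered : ∀ {b hs} → All (_≡ b) hs → Layered b hs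
constant-layered []         = high []
constant-layered (refl ∷ ps) = low (constant-layered ps)

layered-tail : ∀ {b h hs} → Layered b (h ∷ hs) → Layered h hs
layered-tail (low l)            = l
layered-tail (high (refl ∷ ps)) = constant-layered ps

layered-snoc : ∀ {b hs} → Layered b hs → Layered b (hs ++ [ suc b ])
layered-snoc (low l)   = low (layered-snoc l)
layered-snoc (high ps) = high (All.∷ʳ⁺ ps refl)

layered-range : ∀ {b hs} → Layered b hs → All (OneOf b (suc b)) hs
layered-range (low l)   = inj₁ refl ∷ layered-range l
layered-range (high ps) = All.map inj₂ ps

map-replace : {A B : Set} (f : A → B) (xs : List A) {y y' : A} {zs : List A} →
              f y' ≡ f y → map f (xs ++ y' ∷ zs) ≡ map f (xs ++ y ∷ zs)
map-replace f xs {y} {y'} {zs} eq = begin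
  map f (xs ++ y' ∷ zs)       ≡⟨ map-++ f xs (y' ∷ zs) ⟩
  map f xs ++ f y' ∷ map f zs ≡⟨ cong (λ w → map f xs ++ w ∷ map f zs) eq ⟩
  map f xs ++ f y ∷ map f zs  ≡⟨ map-++ f xs (y ∷ zs) ⟨
  map f (xs ++ y ∷ zs)        ∎
  where open ≡-Reasoning

unique-snoc : {A : Set} {xs : List A} {x : A} →
              Unique xs → x ∉ xs → Unique (xs ++ [ x ])
unique-snoc u x∉xs =
  Unique.++⁺ u ([] ∷ []) (λ { (x∈xs , here refl) → x∉xs x∈xs })

module QueueShape {T : Set} (_<_ : T → T → Set) {n : ℕ} (E : List (Edge T n)) where
  open TBFS _<_ E

  key : Rec → Fin n × ℕ
  key q = vertex q , hop q

  Shaped : ℕ → List Rec → Set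
  Shaped b Q = Unique (map key Q) × Layered b (map hop Q)

  Inv : State → Set
  Inv ⟨ _ , Q , _ , nothing ⟩       = ∃ λ b → Shaped b Q
  Inv ⟨ _ , Q , _ , just (r , _) ⟩ = Shaped (hop r) Q

  inv-initial : ∀ s ts → Inv (initial s ts)
  inv-initial s ts = 0 , ([] ∷ []) , low (high [])

  shaped-replace : ∀ {b} Q₁ {q q' Q₂} → key q' ≡ key q →
                   Shaped b (Q₁ ++ q ∷ Q₂) → Shaped b (Q₁ ++ q' ∷ Q₂)
  shaped-replace Q₁ eq (u , l) =
    subst Unique (sym (map-replace key Q₁ eq)) u ,
    subst (Layered _) (sym (map-replace hop Q₁ (cong proj₂ eq))) l

  shaped-push : ∀ {b} Q {v t p} → (v , suc b) ∉ map key Q →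
                Shaped b Q → Shaped b (Q ++ [ rec v (suc b) t p ])
  shaped-push Q {v} {t} {p} fresh (u , l) =
    subst Unique (sym (map-++ key Q [ q ])) (unique-snoc u fresh) ,
    subst (Layered _) (sym (map-++ hop Q [ q ])) (layered-snoc l)
    where q = rec v _ t p

  push-fresh : ∀ {Q v d} → (∀ q → q ∈ Q → vertex q ≡ v → hop q ≢ d) →
               (v , d) ∉ map key Q
  push-fresh noRecord k∈Q with ∈-map⁻ key k∈Q
  ... | q , q∈Q , eq = noRecord q q∈Q (sym (cong proj₁ eq)) (sym (cong proj₂ eq))

  inv-step : ∀ {a b} → a ⟶ b → Inv a → Inv b
  inv-step (pop _)        (_ , _ ∷ distinct , l) = distinct , layered-tail l
  inv-step finish         i = _ , i
  inv-step (skip _)       i = i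
  inv-step (trav-none _ _) i = i
  inv-step (trav-update {Q₁ = Q₁} _ _ refl _) i = shaped-replace Q₁ refl i
  inv-step (trav-push {Q = Q} _ _ noRecord)   i = shaped-push Q (push-fresh noRecord) i

  inv-reachable : ∀ s ts {st} → Reachable s ts st → Inv st
  inv-reachable s ts r =
    fold (λ a b → Inv a → Inv b) (λ step k → k ∘ inv-step step) id
         r (inv-initial s ts)

  inv-shaped : ∀ st → Inv st → ∃ λ b → Shaped b (Q st)
  inv-shaped ⟨ _ , _ , _ , nothing ⟩       i = i
  inv-shaped ⟨ _ , _ , _ , just (r , _) ⟩ i = hop r , i

  shaped-count : ∀ {b} Q v → Shaped b Q → count v Q ≤ 2
  shaped-count {b} Q v (u , l) =
    subst (_≤ 2) (length-map key Vs)
      (unique-two-valued (map key Vs) uniqueVs (All.map⁺ keysVs))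
    where
    Vs : List Rec
    Vs = filter (λ q → vertex q ≟ v) Q

    uniqueVs : Unique (map key Vs)
    uniqueVs = AllPairs.map⁺ (AllPairs.filter⁺ _ (AllPairs.map⁻ u))

    atV : All (λ q → vertex q ≡ v) Vs
    atV = All.all-filter (λ q → vertex q ≟ v) Q

    hopsVs : All (λ q → OneOf b (suc b) (hop q)) Vs
    hopsVs = All.filter⁺ (λ q → vertex q ≟ v) (All.map⁻ (layered-range l))

    keysVs : All (λ q → OneOf (v , b) (v , suc b) (key q)) Vs
    keysVs = All.zipWith (λ {q} → onVertex {q}) (atV , hopsVs)
      where
      onVertex : ∀ {q} → vertex q ≡ v × OneOf b (suc b) (hop q) →
                 OneOf (v , b) (v , suc b) (key q)
      onVertex (vq≡v , inj₁ hq≡b)  = inj₁ (cong₂ _,_ vq≡v hq≡b)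
      onVertex (vq≡v , inj₂ hq≡b+1) = inj₂ (cong₂ _,_ vq≡v hq≡b+1)

lemma15 : {T : Set} (_<_ : T → T → Set) → IsStrictTotalOrder _≡_ _<_ →
    (n : ℕ) (E : List (Edge T n)) → Loopless E →
    (s : Fin n) (ts : T) (st : TBFS.State _<_ E) →
    TBFS.Reachable _<_ E s ts st →
    (v : Fin n) → TBFS.count _<_ E v (TBFS.Q st) ≤ 2
lemma15 _<_ _ n E _ s ts st reach v =
  let (_ , shaped) = inv-shaped st (inv-reachable s ts reach)
  in  shaped-count (TBFS.Q st) v shaped
  where open QueueShape _<_ E
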